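{- For every focused derivation $f$ of $S \mid \Gamma \vdash_{\mathsf L} C$, we have $\mathrm{focus}(\mathrm{emb}_{\mathsf L}\, f) = f$.
   Context: Fix a set $\mathrm{Var}$ of atoms. Formulae: atoms $X \in \mathrm{Var}$, $\mathsf{I}$, and $A \otimes B$. A context is a finite list of formulae; a stoup $S$ is either empty ($-$) or a single formula; a stoup $T$ is irreducible if $T = -$ or $T$ is an atom. Cut-free sequent calculus: sequents $S \mid \Gamma \vdash C$ derived by (ax) $A \mid\ \vdash A$; (pass) from $A \mid \Gamma \vdash C$ infer $- \mid A, \Gamma \vdash C$; ($\mathsf I$L) from $- \mid \Gamma \vdash C$ infer $\mathsf I \mid \Gamma \vdash C$; ($\mathsf I$R) $- \mid\ \vdash \mathsf I$; ($\otimes$L) from $A \mid B, \Gamma \vdash C$ infer $A \otimes B \mid \Gamma \vdash C$; ($\otimes$R) from $S \mid \Gamma \vdash A$ and $- \mid \Delta \vdash B$ infer $S \mid \Gamma, \Delta \vdash A \otimes B$. Focused calculus: sequents $S \mid \Gamma \vdash_{\mathsf L} C$ and $T \mid \Gamma \vdash_{\mathsf R} C$ ($T$ irreducible), derived by: (pass) from $A \mid \Gamma \vdash_{\mathsf L} C$ infer $- \mid A, \Gamma \vdash_{\mathsf L} C$; (switch) from $T \mid \Gamma \vdash_{\mathsf R} C$ infer $T \mid \Gamma \vdash_{\mathsf L} C$; (ax$_X$) $X \mid\ \vdash_{\mathsf R} X$ for atoms $X$; ($\mathsf I$L) from $- \mid \Gamma \vdash_{\mathsf L} C$ infer $\mathsf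 I \mid \Gamma \vdash_{\mathsf L} C$; ($\mathsf I$R$_{\mathsf R}$) $- \mid\ \vdash_{\mathsf R} \mathsf I$; ($\otimes$L) from $A \mid B, \Gamma \vdash_{\mathsf L} C$ infer $A \otimes B \mid \Gamma \vdash_{\mathsf L} C$; ($\otimes$R$_{\mathsf R}$) from $T \mid \Gamma \vdash_{\mathsf R} A$ and $- \mid \Delta \vdash_{\mathsf L} B$ infer $T \mid \Gamma, \Delta \vdash_{\mathsf R} A \otimes B$. $\mathrm{emb}_{\mathsf L}$ (and $\mathrm{emb}_{\mathsf R}$) maps a focused derivation to a cut-free derivation of the same sequent (phase erased) by deleting every switch step and replacing each focused rule by the unfocused rule of the same name (ax$_X$ by ax, $\mathsf I$R$_{\mathsf R}$ by $\mathsf I$R, $\otimes$R$_{\mathsf R}$ by $\otimes$R). $\mathrm{focus}$ maps cut-free derivations of $S \mid \Gamma \vdash C$ to focused derivations of $S \mid \Gamma \vdash_{\mathsf L} C$: $\mathrm{focus}(\mathrm{pass}\, f) = \mathrm{pass}(\mathrm{focus}\, f)$, $\mathrm{focus}(\mathsf I\mathrm L\, f) = \mathsf I\mathrm L(\mathrm{focus}\, f)$, $\mathrm{focus}(\otimes\mathrm L\, f) = \otimes\mathrm L(\mathrm{focus}\, f)$, $\mathrm{focus}(\mathsf I\mathrm R) = \mathrm{switch}(\mathsf I\mathrm R_{\mathsf R})$, $\mathrm{focus}(\otimes\mathrm R(f, g)) = \otimes\mathrm R_{\mathsf L}(\mathrm{focus}\, f, \mathrm{focus}\, g)$, $\mathrm{focus}(\mathrm{ax}_A)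 = \mathrm{ax}_{\mathsf L, A}$. Here $\otimes\mathrm R_{\mathsf L}$ (from $S \mid \Gamma \vdash_{\mathsf L} A$ and $- \mid \Delta \vdash_{\mathsf L} B$ to $S \mid \Gamma,\Delta \vdash_{\mathsf L} A \otimes B$) is defined by recursion on its first argument: $\otimes\mathrm R_{\mathsf L}(\mathrm{pass}\, f, g) = \mathrm{pass}(\otimes\mathrm R_{\mathsf L}(f, g))$, $\otimes\mathrm R_{\mathsf L}(\mathsf I\mathrm L\, f, g) = \mathsf I\mathrm L(\otimes\mathrm R_{\mathsf L}(f, g))$, $\otimes\mathrm R_{\mathsf L}(\otimes\mathrm L\, f, g) = \otimes\mathrm L(\otimes\mathrm R_{\mathsf L}(f, g))$, $\otimes\mathrm R_{\mathsf L}(\mathrm{switch}\, f, g) = \mathrm{switch}(\otimes\mathrm R_{\mathsf R}(f, g))$; and $\mathrm{ax}_{\mathsf L, A} : A \mid\ \vdash_{\mathsf L} A$ by recursion on $A$: $\mathrm{ax}_{\mathsf L, X} = \mathrm{switch}(\mathrm{ax}_X)$, $\mathrm{ax}_{\mathsf L, \mathsf I} = \mathsf I\mathrm L(\mathrm{switch}(\mathsf I\mathrm R_{\mathsf R}))$, $\mathrm{ax}_{\mathsf L, A \otimes B} = \otimes\mathrm L(\otimes\mathrm R_{\mathsf L}(\mathrm{ax}_{\mathsf L, A}, \mathrm{pass}(\mathrm{ax}_{\mathsf L, B})))$. -}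

module Defs where

open import Data.List using (List; []; _∷_; _++_)
open import Data.Maybe using (Maybe; nothing; just)
open import Data.Product using (Σ; _,_)

module Calculus (Var : Set) where

  data Fma : Set where
    ` : Var → Fma
    I : Fma
    _⊗_ : Fma → Fma → Fma

  Cxt : Set
  Cxt = List Fma

  Stp : Set
  Stp = Maybe Fma

  data isIrr : Stp → Set where
    irr-nothing : isIrr nothing
    irr-atom : (X : Var) → isIrr (just (` X))

  Irr : Set
  Irr = Σ Stp isIrr

  irr : Irr → Stp
  irr (S , _) = S

  infix 15 _∣_⊢_
  data _∣_⊢_ : Stp → Cxt → Fma → Set where
    ax : {A : Fma} → just A ∣ [] ⊢ A
    pass : {Γ : Cxt} {A C : Fma} → just A ∣ Γ ⊢ C → nothing ∣ A ∷ Γ ⊢ C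
    Il : {Γ : Cxt} {C : Fma} → nothing ∣ Γ ⊢ C → just I ∣ Γ ⊢ C
    Ir : nothing ∣ [] ⊢ I
    ⊗l : {Γ : Cxt} {A B C : Fma} → just A ∣ B ∷ Γ ⊢ C → just (A ⊗ B) ∣ Γ ⊢ C
    ⊗r : {S : Stp} {Γ Δ : Cxt} {A B : Fma} →
         S ∣ Γ ⊢ A → nothing ∣ Δ ⊢ B → S ∣ Γ ++ Δ ⊢ A ⊗ B

  infix 15 _∣_⊢L_ _∣_⊢R_
  data _∣_⊢L_ : Stp → Cxt → Fma → Set
  data _∣_⊢R_ : Irr → Cxt → Fma → Set

  data _∣_⊢L_ where
    pass : {Γ : Cxt} {A C : Fma} → just A ∣ Γ ⊢L C → nothing ∣ A ∷ Γ ⊢L C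
    switch : {T : Irr} {Γ : Cxt} {C : Fma} → T ∣ Γ ⊢R C → irr T ∣ Γ ⊢L C
    Il : {Γ : Cxt} {C : Fma} → nothing ∣ Γ ⊢L C → just I ∣ Γ ⊢L C
    ⊗l : {Γ : Cxt} {A B C : Fma} → just A ∣ B ∷ Γ ⊢L C → just (A ⊗ B) ∣ Γ ⊢L C

  data _∣_⊢R_ where
    ax : {X : Var} → (just (` X) , irr-atom X) ∣ [] ⊢R ` X
    Ir : (nothing , irr-nothing) ∣ [] ⊢R I
    ⊗r : {T : Irr} {Γ Δ : Cxt} {A B : Fma} →
         T ∣ Γ ⊢R A → nothing ∣ Δ ⊢L B → T ∣ Γ ++ Δ ⊢R A ⊗ B

  embL : {S : Stp} {Γ : Cxt} {C : Fma} → S ∣ Γ ⊢L C → S ∣ Γ ⊢ C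
  embR : {T : Irr} {Γ : Cxt} {C : Fma} → T ∣ Γ ⊢R C → irr T ∣ Γ ⊢ C
  embL (pass f) = pass (embL f)
  embL (switch f) = embR f
  embL (Il f) = Il (embL f)
  embL (⊗l f) = ⊗l (embL f)
  embR ax = ax
  embR Ir = Ir
  embR (⊗r f g) = ⊗r (embR f) (embL g)

  ⊗rL : {S : Stp} {Γ Δ : Cxt} {A B : Fma} →
        S ∣ Γ ⊢L A → nothing ∣ Δ ⊢L B → S ∣ Γ ++ Δ ⊢L A ⊗ B
  ⊗rL (pass f) g = pass (⊗rL f g)
  ⊗rL (Il f) g = Il (⊗rL f g)
  ⊗rL (⊗l f) g = ⊗l (⊗rL f g)
  ⊗rL (switch f) g = switch (⊗r f g)

  axL : {A : Fma} → just A ∣ [] ⊢L A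
  axL {` X} = switch ax
  axL {I} = Il (switch Ir)
  axL {A ⊗ B} = ⊗l (⊗rL axL (pass axL))

  focus : {S : Stp} {Γ : Cxt} {C : Fma} → S ∣ Γ ⊢ C → S ∣ Γ ⊢L C
  focus ax = axL
  focus (pass f) = pass (focus f)
  focus (Il f) = Il (focus f)
  focus Ir = switch Ir
  focus (⊗l f) = ⊗l (focus f)
  focus (⊗r f g) = ⊗rL (focus f) (focus g)

{-# OPTIONS --safe #-}
module Submission where

open import Defs
open import Relation.Binary.PropositionalEquality using (_≡_; refl; cong; cong₂)

module _ (Var : Set) where
  open Calculus Var

  focus∘embL≗id : {S : Stp} {Γ : Cxt} {C : Fma} (f : S ∣ Γ ⊢L C) → focus (embL f) ≡ f
  focus∘embR≗switch : {T : Irr} {Γ : Cxt} {C : Fma} (f : T ∣ Γ ⊢R C) →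
                      focus (embR f) ≡ switch f

  focus∘embL≗id (pass f) = cong pass (focus∘embL≗id f)
  focus∘embL≗id (switch f) = focus∘embR≗switch f
  focus∘embL≗id (Il f) = cong Il (focus∘embL≗id f)
  focus∘embL≗id (⊗l f) = cong ⊗l (focus∘embL≗id f)

  -- switch (⊗r f g) is ⊗rL (switch f) g by definition, so the ⊗r case is a congruence.
  focus∘embR≗switch ax = refl
  focus∘embR≗switch Ir = refl
  focus∘embR≗switch (⊗r f g) = cong₂ ⊗rL (focus∘embR≗switch f) (focus∘embL≗id g)

lemma5p4 : (Var : Set) → let open Calculus Var in
    {S : Stp} {Γ : Cxt} {C : Fma} (f : S ∣ Γ ⊢L C) → focus (embL f) ≡ f
lemma5p4 = focus∘embL≗id
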